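{- Let $\varepsilon,a>0$. There exists $n_0$ such that the following holds for all $n\ge n_0$. Let $G$ be a directed graph on $n$ vertices with $\delta^+(G),\delta^-(G)\ge n^a$, let $m\in[n/2,n]$ be an integer, and let $G'$ be the induced subdigraph obtained from $G$ by deleting each vertex independently with probability $p=1-m/n$. Then with positive probability the following all occur simultaneously: $\delta^+(G')\ge(1-\varepsilon)(1-p)\delta^+(G)$, $\delta^-(G')\ge(1-\varepsilon)(1-p)\delta^-(G)$, and $|V(G')|=m$.
   Context: Digraphs have no loops and no parallel edges. $\delta^+(G)$ and $\delta^-(G)$ denote the minimum outdegree and minimum indegree of $G$.
   Formalization: The parameters ε and a range over the positive rationals. -}

module Defs where

open import Data.Bool using (Bool; true; false; if_then_else_; _∧_)
open import Data.Nat as ℕ using (ℕ; zero; suc; _⊓_; _^_; _≤_)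
open import Data.Fin using (Fin; zero; suc)
open import Data.List using (List; []; _∷_; [_]; map; concatMap; foldr; allFin; length)
open import Data.Integer using (+_)
open import Data.Nat.ListAction using (sum)
open import Data.Rational using (ℚ; 0ℚ; 1ℚ; _/_; _+_; _*_; _-_)
open import Data.Rational.Properties using (_≤?_)
open import Relation.Binary.PropositionalEquality using (_≡_)
open import Relation.Nullary using (does)
open import Data.Product using (_×_)

record Digraph (n : ℕ) : Set where
  field
    adj      : Fin n → Fin n → Bool
    loopless : ∀ v → adj v v ≡ false
open Digraph public

-- A vertex subset (the set of surviving vertices).
VSet : ℕ → Set
VSet n = Fin n → Bool

countB : ∀ {n} → (Fin n → Bool) → ℕ
countB {n} P = sum (map (λ j → if P j then 1 else 0) (allFin n))

-- minimum of a list of naturals (0 for the empty list, never used for nonempty)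
minList : List ℕ → ℕ
minList []           = 0
minList (x ∷ [])     = x
minList (x ∷ y ∷ xs) = x ⊓ minList (y ∷ xs)

verts : ∀ {n} → VSet n → List (Fin n)
verts {n} S = concatMap (λ v → if S v then [ v ] else []) (allFin n)

full : ∀ {n} → VSet n
full _ = true

outdegIn : ∀ {n} → Digraph n → VSet n → Fin n → ℕ
outdegIn G S v = countB (λ w → S w ∧ adj G v w)

indegIn : ∀ {n} → Digraph n → VSet n → Fin n → ℕ
indegIn G S v = countB (λ w → S w ∧ adj G w v)

δ⁺In : ∀ {n} → Digraph n → VSet n → ℕ
δ⁺In G S = minList (map (outdegIn G S) (verts S))

δ⁻In : ∀ {n} → Digraph n → VSet n → ℕ
δ⁻In G S = minList (map (indegIn G S) (verts S))

δ⁺ : ∀ {n} → Digraph n → ℕ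
δ⁺ G = δ⁺In G full

δ⁻ : ∀ {n} → Digraph n → ℕ
δ⁻ G = δ⁻In G full

size : ∀ {n} → VSet n → ℕ
size S = length (verts S)

toℚ : ℕ → ℚ
toℚ k = (+ k) / 1

-- the ratio m/n as a rational (n = 0 never arises meaningfully; set to 0)
ratio : ℕ → ℕ → ℚ
ratio m zero    = 0ℚ
ratio m (suc k) = (+ m) / suc k

extend : ∀ {n} → Bool → VSet n → VSet (suc n)
extend b S zero    = b
extend b S (suc i) = S i

allSubsets : (n : ℕ) → List (VSet n)
allSubsets zero    = [ (λ ()) ]
allSubsets (suc n) = concatMap (λ S → extend false S ∷ extend true S ∷ []) (allSubsets n)

sumℚ : List ℚ → ℚ
sumℚ = foldr _+_ 0ℚ

productℚ : List ℚ → ℚ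
productℚ = foldr _*_ 1ℚ

-- probability of the outcome S when each vertex is deleted independently
-- with probability p (kept with probability 1 - p)
weight : ∀ {n} → ℚ → VSet n → ℚ
weight {n} p S = productℚ (map (λ i → if S i then 1ℚ - p else p) (allFin n))

Pr : ∀ {n} → ℚ → (VSet n → Bool) → ℚ
Pr {n} p E = sumℚ (map (λ S → if E S then weight p S else 0ℚ) (allSubsets n))

-- atLeastPow d n a b  means  d ≥ n^(a/b), i.e. n^a ≤ d^b (exact for naturals)
atLeastPow : ℕ → ℕ → ℕ → ℕ → Set
atLeastPow d n a b = n ^ a ≤ d ^ b

event : ∀ {n} → Digraph n → ℚ → ℚ → ℕ → VSet n → Bool
event G ε p m S =
  does (((1ℚ - ε) * (1ℚ - p)) * toℚ (δ⁺ G) ≤? toℚ (δ⁺In G S))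
  ∧ does (((1ℚ - ε) * (1ℚ - p)) * toℚ (δ⁻ G) ≤? toℚ (δ⁻In G S))
  ∧ does (size S ℕ.≟ m)

{-# OPTIONS --safe #-}
-- Every m-subset S of the vertices has positive probability, so it suffices to exhibit one in
-- which every vertex keeps at least (1 - 1/E)(m/n)δ of its out- and in-neighbours, 1/E ≤ ε.
-- The number of m-subsets meeting a k-set in exactly j points is C(k,j)·C(n-k,m-j), and below
-- (1 - 1/(2E))·mk/n consecutive terms grow by a factor (x+1)/x, x = 4E - 1. A low value j is
-- followed by D ≈ δ/(4E) such steps, so the m-subsets in which a given vertex is low make up
-- at most a fraction (n+1)(x/(x+1))^D of all m-subsets. Since δ ≥ n^(a/b), (1 + 1/x)^D
-- outgrows 2n(n+1), and a union bound over the 2n degree conditions leaves a good m-subset.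
module Submission where

open import Defs
open import Data.Bool using (Bool; true; false; T; not; _∧_; _∨_; if_then_else_)
open import Data.Bool.ListAction using (any)
open import Data.Bool.Properties using (T-∧; T-∨; T-not-≡; ∧-zeroʳ; ∧-distribˡ-∨)
open import Data.Empty using (⊥-elim)
open import Data.Fin using (Fin; zero; suc)
open import Data.List using (List; []; _∷_; [_]; map; length; concatMap; allFin; upTo)
open import Data.List.Membership.Propositional using (_∈_)
open import Data.List.Membership.Propositional.Properties using (∈-allFin; ∈-map⁺; ∈-map⁻; ∈-upTo⁺)
open import Data.List.Properties using (concatMap-pure; length-tabulate; length-upTo; map-tabulate)
open import Data.List.Relation.Unary.Any using (Any; here; there)
import Data.List.Relation.Unary.Any as Any
open import Data.List.Relation.Unary.Any.Properties using (any⁺)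
open import Data.Product using (∃-syntax; _,_; _×_; proj₁; proj₂)
open import Data.Sum using (inj₁; inj₂)
open import Function using (_∘_)
open import Function.Bundles using (Equivalence)
open import Relation.Binary.PropositionalEquality hiding ([_])
open import Relation.Nullary using (¬_; Dec; yes; no; does; contradiction)

module _ where

  open import Data.Nat
  open import Data.Nat.Properties
  open import Data.Nat.Combinatorics using (_C_; nC1≡n; nCk+nC[k+1]≡[n+1]C[k+1]; k>n⇒nCk≡0)
  open import Data.Nat.DivMod using (_/_; _%_; m≡m%n+[m/n]*n; m%n<n; m/n*n≤m)
  open import Data.Nat.ListAction using (sum)
  open import Data.Nat.Solver using (module +-*-Solver)
  open +-*-Solver

  -- Binomial coefficients

  nC[1+k]*[1+k]+nCk*k≡nCk*n : ∀ n k → (n C suc k) * suc k + (n C k) * k ≡ (n C k) * n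
  nC[1+k]*[1+k]+nCk*k≡nCk*n zero    zero    = refl
  nC[1+k]*[1+k]+nCk*k≡nCk*n zero    (suc k) = refl
  nC[1+k]*[1+k]+nCk*k≡nCk*n (suc n) zero
    rewrite nC1≡n (suc n) | *-identityʳ n | +-identityʳ n = refl
  nC[1+k]*[1+k]+nCk*k≡nCk*n (suc n) (suc k) = begin
    (suc n C (2 + k)) * (2 + k) + (suc n C suc k) * suc k
      ≡⟨ sym (cong₂ (λ p q → p * (2 + k) + q * suc k)
               (nCk+nC[k+1]≡[n+1]C[k+1] n (suc k)) (nCk+nC[k+1]≡[n+1]C[k+1] n k)) ⟩
    (b + c) * (2 + k) + (a + b) * suc k
      ≡⟨ solve 4 (λ a b c k → (b :+ c) :* (con 2 :+ k) :+ (a :+ b) :* (con 1 :+ k)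
                   := (c :* (con 2 :+ k) :+ b :* (con 1 :+ k)) :+ (b :* (con 1 :+ k) :+ a :* k) :+ (a :+ b))
                 refl a b c k ⟩
    (c * (2 + k) + b * suc k) + (b * suc k + a * k) + (a + b)
      ≡⟨ cong₂ (λ p q → p + q + (a + b))
               (nC[1+k]*[1+k]+nCk*k≡nCk*n n (suc k)) (nC[1+k]*[1+k]+nCk*k≡nCk*n n k) ⟩
    b * n + a * n + (a + b)
      ≡⟨ solve 3 (λ a b n → b :* n :+ a :* n :+ (a :+ b) := (a :+ b) :* (con 1 :+ n)) refl a b n ⟩
    (a + b) * suc n
      ≡⟨ cong (_* suc n) (nCk+nC[k+1]≡[n+1]C[k+1] n k) ⟩
    (suc n C suc k) * suc n ∎
    where
    open ≡-Reasoning
    a = n C k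
    b = n C suc k
    c = n C (2 + k)

  nC[1+k]*[1+k]≡nCk*[n∸k] : ∀ n k → (n C suc k) * suc k ≡ (n C k) * (n ∸ k)
  nC[1+k]*[1+k]≡nCk*[n∸k] n k with k ≤? n
  ... | yes k≤n = +-cancelʳ-≡ ((n C k) * k) _ _ (begin
    (n C suc k) * suc k + (n C k) * k  ≡⟨ nC[1+k]*[1+k]+nCk*k≡nCk*n n k ⟩
    (n C k) * n                        ≡⟨ cong ((n C k) *_) (sym (m∸n+n≡m k≤n)) ⟩
    (n C k) * (n ∸ k + k)              ≡⟨ *-distribˡ-+ (n C k) (n ∸ k) k ⟩
    (n C k) * (n ∸ k) + (n C k) * k    ∎)
    where open ≡-Reasoning
  ... | no k≰n = begin
    (n C suc k) * suc k  ≡⟨ cong (_* suc k) (k>n⇒nCk≡0 (m<n⇒m<1+n (≰⇒> k≰n))) ⟩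
    0                    ≡⟨ sym (*-zeroʳ (n C k)) ⟩
    (n C k) * 0          ≡⟨ cong ((n C k) *_) (sym (m≤n⇒m∸n≡0 (<⇒≤ (≰⇒> k≰n)))) ⟩
    (n C k) * (n ∸ k)    ∎
    where open ≡-Reasoning

  pascal-*ʳ : ∀ n k x → (n C suc k) * x + (n C k) * x ≡ (suc n C suc k) * x
  pascal-*ʳ n k x = begin
    (n C suc k) * x + (n C k) * x  ≡⟨ sym (*-distribʳ-+ x (n C suc k) (n C k)) ⟩
    ((n C suc k) + (n C k)) * x    ≡⟨ cong (_* x) (+-comm (n C suc k) (n C k)) ⟩
    ((n C k) + (n C suc k)) * x    ≡⟨ cong (_* x) (nCk+nC[k+1]≡[n+1]C[k+1] n k) ⟩
    (suc n C suc k) * x            ∎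
    where open ≡-Reasoning

  pascal-*ˡ : ∀ n k x → x * (n C suc k) + x * (n C k) ≡ x * (suc n C suc k)
  pascal-*ˡ n k x = begin
    x * (n C suc k) + x * (n C k)  ≡⟨ cong₂ _+_ (*-comm x (n C suc k)) (*-comm x (n C k)) ⟩
    (n C suc k) * x + (n C k) * x  ≡⟨ pascal-*ʳ n k x ⟩
    (suc n C suc k) * x            ≡⟨ *-comm (suc n C suc k) x ⟩
    x * (suc n C suc k)            ∎
    where open ≡-Reasoning

  k≤n⇒nCk>0 : ∀ {n k} → k ≤ n → 0 < n C k
  k≤n⇒nCk>0 {n}     {zero}  _         = z<s
  k≤n⇒nCk>0 {suc n} {suc k} (s≤s k≤n) = begin-strict
    0                      <⟨ k≤n⇒nCk>0 k≤n ⟩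
    n C k                  ≤⟨ m≤m+n (n C k) (n C suc k) ⟩
    (n C k) + (n C suc k)  ≡⟨ nCk+nC[k+1]≡[n+1]C[k+1] n k ⟩
    suc n C suc k          ∎
    where open ≤-Reasoning

  -- Growth of powers

  [m*n]^o≡m^o*n^o : ∀ m n o → (m * n) ^ o ≡ m ^ o * n ^ o
  [m*n]^o≡m^o*n^o m n zero    = refl
  [m*n]^o≡m^o*n^o m n (suc o) rewrite [m*n]^o≡m^o*n^o m n o =
    solve 4 (λ a b c d → (a :* b) :* (c :* d) := (a :* c) :* (b :* d)) refl m n (m ^ o) (n ^ o)

  n<2^n : ∀ n → n < 2 ^ n
  n<2^n zero    = s≤s z≤n
  n<2^n (suc n) = +-mono-≤ (m^n>0 2 n) (≤-trans (n<2^n n) (m≤m+n (2 ^ n) 0))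

  n≤n^a : ∀ n a .{{_ : NonZero a}} → n ≤ n ^ a
  n≤n^a zero    (suc a) = z≤n
  n≤n^a (suc n) (suc a) = begin
    suc n              ≡⟨ sym (*-identityʳ (suc n)) ⟩
    suc n * 1          ≤⟨ *-monoʳ-≤ (suc n) (m^n>0 (suc n) a) ⟩
    suc n * suc n ^ a  ∎
    where open ≤-Reasoning

  n≤[m⊓o]^b : ∀ {n a b m o} .{{_ : NonZero a}} → n ^ a ≤ m ^ b → n ^ a ≤ o ^ b → n ≤ (m ⊓ o) ^ b
  n≤[m⊓o]^b {n} {a} {b} {m} {o} nᵃ≤mᵇ nᵃ≤oᵇ with ⊓-sel m o
  ... | inj₁ m⊓o≡m rewrite m⊓o≡m = ≤-trans (n≤n^a n a) nᵃ≤mᵇ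
  ... | inj₂ m⊓o≡o rewrite m⊓o≡o = ≤-trans (n≤n^a n a) nᵃ≤oᵇ

  ^-cancelʳ-≤ : ∀ b .{{_ : NonZero b}} {m n} → m ^ b ≤ n ^ b → m ≤ n
  ^-cancelʳ-≤ b {m} {n} mᵇ≤nᵇ with m ≤? n
  ... | yes m≤n = m≤n
  ... | no  m≰n = contradiction mᵇ≤nᵇ (<⇒≱ (^-monoˡ-< b (≰⇒> m≰n)))

  m<n*[1+m/n] : ∀ m n .{{_ : NonZero n}} → m < n * suc (m / n)
  m<n*[1+m/n] m n = begin-strict
    m                  ≡⟨ m≡m%n+[m/n]*n m n ⟩
    m % n + m / n * n  <⟨ +-monoˡ-< (m / n * n) (m%n<n m n) ⟩
    suc (m / n) * n    ≡⟨ *-comm (suc (m / n)) n ⟩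
    n * suc (m / n)    ∎
    where open ≤-Reasoning

  -- x·(x^s + s·x^(s-1)) ≤ x·(1 + x)^s, stated without subtraction.
  bernoulli : ∀ x s → x ^ suc s + s * x ^ s ≤ x * suc x ^ s
  bernoulli x zero    = ≤-reflexive (+-identityʳ (x * 1))
  bernoulli x (suc s) = begin
    x ^ suc (suc s) + suc s * x ^ suc s              ≤⟨ m≤m+n _ (s * x ^ s) ⟩
    x ^ suc (suc s) + suc s * x ^ suc s + s * x ^ s
      ≡⟨ solve 3 (λ x s a → x :* (x :* a) :+ (con 1 :+ s) :* (x :* a) :+ s :* a
                     := (con 1 :+ x) :* (x :* a :+ s :* a)) refl x s (x ^ s) ⟩
    suc x * (x ^ suc s + s * x ^ s)                  ≤⟨ *-monoʳ-≤ (suc x) (bernoulli x s) ⟩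
    suc x * (x * suc x ^ s)
      ≡⟨ solve 2 (λ x a → (con 1 :+ x) :* (x :* a) := x :* ((con 1 :+ x) :* a)) refl x (suc x ^ s) ⟩
    x * suc x ^ suc s                                ∎
    where open ≤-Reasoning

  2*n^n≤[1+n]^n : ∀ n .{{_ : NonZero n}} → 2 * n ^ n ≤ suc n ^ n
  2*n^n≤[1+n]^n n = *-cancelˡ-≤ n (begin
    n * (2 * n ^ n)        ≡⟨ solve 2 (λ x a → x :* (con 2 :* a) := x :* a :+ x :* a) refl n (n ^ n) ⟩
    n ^ suc n + n * n ^ n  ≤⟨ bernoulli n n ⟩
    n * suc n ^ n          ∎)
    where open ≤-Reasoning

  2^s*n^[n*s]≤[1+n]^[n*s] : ∀ n .{{_ : NonZero n}} s → 2 ^ s * n ^ (n * s) ≤ suc n ^ (n * s)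
  2^s*n^[n*s]≤[1+n]^[n*s] n s = begin
    2 ^ s * n ^ (n * s)  ≡⟨ cong (2 ^ s *_) (sym (^-*-assoc n n s)) ⟩
    2 ^ s * (n ^ n) ^ s  ≡⟨ sym ([m*n]^o≡m^o*n^o 2 (n ^ n) s) ⟩
    (2 * n ^ n) ^ s      ≤⟨ ^-monoˡ-≤ s (2*n^n≤[1+n]^n n) ⟩
    (suc n ^ n) ^ s      ≡⟨ ^-*-assoc (suc n) n s ⟩
    suc n ^ (n * s)      ∎
    where open ≤-Reasoning

  N<2^s⇒N*n^[n*s]<[1+n]^[n*s] : ∀ n .{{_ : NonZero n}} {N s} → N < 2 ^ s → N * n ^ (n * s) < suc n ^ (n * s)
  N<2^s⇒N*n^[n*s]<[1+n]^[n*s] n {N} {s} N<2ˢ = begin-strict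
    N * n ^ (n * s)      <⟨ *-monoˡ-< (n ^ (n * s)) {{m^n≢0 n (n * s)}} N<2ˢ ⟩
    2 ^ s * n ^ (n * s)  ≤⟨ 2^s*n^[n*s]≤[1+n]^[n*s] n s ⟩
    suc n ^ (n * s)      ∎
    where open ≤-Reasoning

  -- Write s = q w + r with q = p + 1; then (s + 1)^p ≤ q^p (w + 1)^p, and w + 1 > M q^p
  -- once s ≥ q (M q^p + 1).
  poly<exp : ∀ M p → ∃[ s₀ ] ∀ s → s₀ ≤ s → M * suc s ^ p < 2 ^ s
  poly<exp M p = q * suc K , bound
    where
    q = suc p
    K = M * q ^ p
    bound : ∀ s → q * suc K ≤ s → M * suc s ^ p < 2 ^ s
    bound s s₀≤s = begin-strict
      M * suc s ^ p            ≤⟨ *-monoʳ-≤ M (^-monoˡ-≤ p (m<n*[1+m/n] s q)) ⟩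
      M * (q * suc w) ^ p      ≡⟨ cong (M *_) ([m*n]^o≡m^o*n^o q (suc w) p) ⟩
      M * (q ^ p * suc w ^ p)  ≡⟨ sym (*-assoc M (q ^ p) (suc w ^ p)) ⟩
      K * suc w ^ p            <⟨ *-monoˡ-< (suc w ^ p) {{m^n≢0 (suc w) p}} K<1+w ⟩
      suc w ^ q                ≤⟨ ^-monoˡ-≤ q (n<2^n w) ⟩
      (2 ^ w) ^ q              ≡⟨ ^-*-assoc 2 w q ⟩
      2 ^ (w * q)              ≤⟨ ^-monoʳ-≤ 2 (m/n*n≤m s q) ⟩
      2 ^ s                    ∎
      where
      open ≤-Reasoning
      w = s / q
      K<1+w : K < suc w
      K<1+w = <⇒≤ (*-cancelˡ-< q (suc K) (suc w) (≤-<-trans s₀≤s (m<n*[1+m/n] s q)))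

  n*2[1+n]<2^s : ∀ B b → ∃[ s₀ ] ∀ {s n} → s₀ ≤ s → n ≤ (B * suc s) ^ b → n * (2 * suc n) < 2 ^ s
  n*2[1+n]<2^s B b = s₀ , bound
    where
    M = 4 * (B ^ b * B ^ b)
    s₀ = proj₁ (poly<exp M (b + b))
    bound : ∀ {s n} → s₀ ≤ s → n ≤ (B * suc s) ^ b → n * (2 * suc n) < 2 ^ s
    bound {s} {zero}  _    _   = m^n>0 2 s
    bound {s} {suc n} s₀≤s n≤Z = begin-strict
      suc n * (2 * suc (suc n))
        ≤⟨ *-mono-≤ n≤Z (*-monoʳ-≤ 2 (+-mono-≤ (≤-trans (s≤s z≤n) n≤Z) n≤Z)) ⟩
      Z * (2 * (Z + Z))
        ≡⟨ cong (λ z → z * (2 * (z + z))) ([m*n]^o≡m^o*n^o B (suc s) b) ⟩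
      Bᵇ * sᵇ * (2 * (Bᵇ * sᵇ + Bᵇ * sᵇ))
        ≡⟨ solve 2 (λ a c → a :* c :* (con 2 :* (a :* c :+ a :* c)) := con 4 :* (a :* a) :* (c :* c)) refl Bᵇ sᵇ ⟩
      M * (sᵇ * sᵇ)
        ≡⟨ cong (M *_) (sym (^-distribˡ-+-* (suc s) b b)) ⟩
      M * suc s ^ (b + b)
        <⟨ proj₂ (poly<exp M (b + b)) s s₀≤s ⟩
      2 ^ s ∎
      where
      open ≤-Reasoning
      Z = (B * suc s) ^ b
      Bᵇ = B ^ b
      sᵇ = suc s ^ b

  -- D = x·⌊δ/(4Ex)⌋ satisfies 4ED ≤ δ, and (1 + 1/x)^D ≥ 2^⌊δ/(4Ex)⌋ outgrows every
  -- polynomial in δ, hence 2n(n+1) once n ≤ δ^b.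
  window-length : ∀ E .{{_ : NonZero E}} x .{{_ : NonZero x}} b →
    ∃[ K ] 0 < K × ∀ {δ n} → K ≤ δ → n ≤ δ ^ b →
      ∃[ D ] 16 * E ≤ δ × 4 * E * D ≤ δ × n * (2 * suc n) * x ^ D < suc x ^ D
  window-length E x b = K , ≤-trans (>-nonZero⁻¹ (16 * E) {{m*n≢0 16 E}}) (m≤n+m (16 * E) (B * s₀)) , window
    where
    B = 4 * E * x
    instance
      B≢0 : NonZero B
      B≢0 = m*n≢0 (4 * E) x {{m*n≢0 4 E}}
    s₀ = proj₁ (n*2[1+n]<2^s B b)
    K = B * s₀ + 16 * E
    window : ∀ {δ n} → K ≤ δ → n ≤ δ ^ b →
             ∃[ D ] 16 * E ≤ δ × 4 * E * D ≤ δ × n * (2 * suc n) * x ^ D < suc x ^ D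
    window {δ} {n} K≤δ n≤δᵇ =
      x * s , ≤-trans (m≤n+m (16 * E) (B * s₀)) K≤δ , 4ED≤δ ,
      N<2^s⇒N*n^[n*s]<[1+n]^[n*s] x
        (proj₂ (n*2[1+n]<2^s B b) s₀≤s (≤-trans n≤δᵇ (^-monoˡ-≤ b (<⇒≤ δ<B[1+s]))))
      where
      s = δ / B
      δ<B[1+s] : δ < B * suc s
      δ<B[1+s] = m<n*[1+m/n] δ B
      4ED≤δ : 4 * E * (x * s) ≤ δ
      4ED≤δ = begin
        4 * E * (x * s)  ≡⟨ sym (*-assoc (4 * E) x s) ⟩
        B * s            ≡⟨ *-comm B s ⟩
        s * B            ≤⟨ m/n*n≤m δ B ⟩
        δ                ∎
        where open ≤-Reasoning
      s₀≤s : s₀ ≤ s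
      s₀≤s = ≤-pred (*-cancelˡ-< B s₀ (suc s) (≤-<-trans (≤-trans (m≤m+n (B * s₀) (16 * E)) K≤δ) δ<B[1+s]))

  -- Counting subsets

  private
    variable
      A B : Set
      n : ℕ

  countᵇ : (A → Bool) → List A → ℕ
  countᵇ p xs = sum (map (λ x → if p x then 1 else 0) xs)

  module _ {p q : A → Bool} where

    countᵇ-cong : (∀ x → p x ≡ q x) → ∀ xs → countᵇ p xs ≡ countᵇ q xs
    countᵇ-cong p≗q []       = refl
    countᵇ-cong p≗q (x ∷ xs) = cong₂ _+_ (cong (λ b → if b then 1 else 0) (p≗q x)) (countᵇ-cong p≗q xs)

    countᵇ-mono : (∀ x → T (p x) → T (q x)) → ∀ xs → countᵇ p xs ≤ countᵇ q xs
    countᵇ-mono p⇒q []       = z≤n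
    countᵇ-mono p⇒q (x ∷ xs) with p x | q x | p⇒q x
    ... | true  | true  | _     = s≤s (countᵇ-mono p⇒q xs)
    ... | true  | false | px⇒⊥ = ⊥-elim (px⇒⊥ _)
    ... | false | _     | _     = ≤-trans (countᵇ-mono p⇒q xs) (m≤n+m _ _)

    countᵇ-∧-not : ∀ xs → countᵇ (λ x → p x ∧ q x) xs + countᵇ (λ x → p x ∧ not (q x)) xs ≡ countᵇ p xs
    countᵇ-∧-not []       = refl
    countᵇ-∧-not (x ∷ xs) with p x | q x
    ... | true  | true  = cong suc (countᵇ-∧-not xs)
    ... | true  | false = trans (+-suc _ _) (cong suc (countᵇ-∧-not xs))
    ... | false | _     = countᵇ-∧-not xs

    countᵇ-∨ : ∀ xs → countᵇ (λ x → p x ∨ q x) xs ≤ countᵇ p xs + countᵇ q xs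
    countᵇ-∨ []       = z≤n
    countᵇ-∨ (x ∷ xs) with p x | q x
    ... | true  | true  = s≤s (≤-trans (countᵇ-∨ xs) (+-monoʳ-≤ _ (n≤1+n _)))
    ... | true  | false = s≤s (countᵇ-∨ xs)
    ... | false | true  = ≤-trans (s≤s (countᵇ-∨ xs)) (≤-reflexive (sym (+-suc _ _)))
    ... | false | false = countᵇ-∨ xs

  countᵇ-false : ∀ (xs : List A) → countᵇ (λ _ → false) xs ≡ 0
  countᵇ-false []       = refl
  countᵇ-false (x ∷ xs) = countᵇ-false xs

  countᵇ-true : ∀ (xs : List A) → countᵇ (λ _ → true) xs ≡ length xs
  countᵇ-true []       = refl
  countᵇ-true (x ∷ xs) = cong suc (countᵇ-true xs)

  countᵇ≤length : ∀ (p : A → Bool) xs → countᵇ p xs ≤ length xs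
  countᵇ≤length p xs = ≤-trans (countᵇ-mono (λ _ _ → _) xs) (≤-reflexive (countᵇ-true xs))

  countᵇ-map : ∀ (p : B → Bool) (f : A → B) xs → countᵇ p (map f xs) ≡ countᵇ (p ∘ f) xs
  countᵇ-map p f []       = refl
  countᵇ-map p f (x ∷ xs) = cong (_ +_) (countᵇ-map p f xs)

  countᵇ-pairs : ∀ (p : B → Bool) (f g : A → B) xs →
                 countᵇ p (concatMap (λ x → f x ∷ g x ∷ []) xs) ≡ countᵇ (p ∘ f) xs + countᵇ (p ∘ g) xs
  countᵇ-pairs p f g []       = refl
  countᵇ-pairs p f g (x ∷ xs) = begin
    a + (b + countᵇ p (concatMap (λ x → f x ∷ g x ∷ []) xs))
      ≡⟨ cong (λ r → a + (b + r)) (countᵇ-pairs p f g xs) ⟩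
    a + (b + (countᵇ (p ∘ f) xs + countᵇ (p ∘ g) xs))
      ≡⟨ solve 4 (λ a b c d → a :+ (b :+ (c :+ d)) := (a :+ c) :+ (b :+ d)) refl a b _ _ ⟩
    (a + countᵇ (p ∘ f) xs) + (b + countᵇ (p ∘ g) xs) ∎
    where
    open ≡-Reasoning
    a = if p (f x) then 1 else 0
    b = if p (g x) then 1 else 0

  countᵇ-∧-any : ∀ (p : A → Bool) (q : B → A → Bool) vs xs →
    countᵇ (λ x → p x ∧ any (λ v → q v x) vs) xs ≤ sum (map (λ v → countᵇ (λ x → p x ∧ q v x) xs) vs)
  countᵇ-∧-any p q []       xs = ≤-reflexive (trans (countᵇ-cong (λ x → ∧-zeroʳ (p x)) xs) (countᵇ-false xs))
  countᵇ-∧-any p q (v ∷ vs) xs = begin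
    countᵇ (λ x → p x ∧ (q v x ∨ any (λ v → q v x) vs)) xs
      ≡⟨ countᵇ-cong (λ x → ∧-distribˡ-∨ (p x) (q v x) _) xs ⟩
    countᵇ (λ x → (p x ∧ q v x) ∨ (p x ∧ any (λ v → q v x) vs)) xs
      ≤⟨ countᵇ-∨ xs ⟩
    countᵇ (λ x → p x ∧ q v x) xs + countᵇ (λ x → p x ∧ any (λ v → q v x) vs) xs
      ≤⟨ +-monoʳ-≤ _ (countᵇ-∧-any p q vs xs) ⟩
    sum (map (λ v → countᵇ (λ x → p x ∧ q v x) xs) (v ∷ vs)) ∎
    where open ≤-Reasoning

  ∈⇒countᵇ>0 : ∀ {p : A → Bool} {x xs} → x ∈ xs → T (p x) → 0 < countᵇ p xs
  ∈⇒countᵇ>0 {p = p} {xs = y ∷ ys} (here refl) px with p y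
  ... | true = s≤s z≤n
  ∈⇒countᵇ>0 {p = p} {xs = y ∷ ys} (there x∈ys) px = ≤-trans (∈⇒countᵇ>0 x∈ys px) (m≤n+m _ _)

  countᵇ>0⇒any : ∀ (p : A → Bool) xs → 0 < countᵇ p xs → Any (T ∘ p) xs
  countᵇ>0⇒any p (x ∷ xs) pos with p x in px
  ... | true  = here (subst T (sym px) _)
  ... | false = there (countᵇ>0⇒any p xs pos)

  T-not-any : ∀ (p : A → Bool) {x xs} → T (not (any p xs)) → x ∈ xs → ¬ T (p x)
  T-not-any p {xs = xs} ¬any x∈xs px =
    subst T (Equivalence.to (T-not-≡ {any p xs}) ¬any) (any⁺ p (Any.map (λ { refl → px }) x∈xs))

  c*sum≤length*d : ∀ c d (f : A → ℕ) → (∀ x → c * f x ≤ d) → ∀ xs → c * sum (map f xs) ≤ length xs * d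
  c*sum≤length*d c d f bound []       = ≤-reflexive (*-zeroʳ c)
  c*sum≤length*d c d f bound (x ∷ xs) = begin
    c * (f x + sum (map f xs))    ≡⟨ *-distribˡ-+ c (f x) _ ⟩
    c * f x + c * sum (map f xs)  ≤⟨ +-mono-≤ (bound x) (c*sum≤length*d c d f bound xs) ⟩
    d + length xs * d             ∎
    where open ≤-Reasoning

  countB-suc : ∀ (A : VSet (suc n)) → countB A ≡ (if A zero then 1 else 0) + countB (A ∘ suc)
  countB-suc {n} A = cong ((if A zero then 1 else 0) +_)
    (trans (cong (countᵇ A) (sym (map-tabulate (λ i → i) suc))) (countᵇ-map A suc (allFin n)))

  countB≤n : ∀ (A : VSet n) → countB A ≤ n
  countB≤n {n} A = ≤-trans (countᵇ≤length A (allFin n)) (≤-reflexive (length-tabulate (λ i → i)))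

  countB-full : countB (full {n}) ≡ n
  countB-full {n} = trans (countᵇ-true (allFin n)) (length-tabulate (λ i → i))

  countB+countB-not≡n : ∀ (A : VSet n) → countB A + countB (not ∘ A) ≡ n
  countB+countB-not≡n {n} A = trans (countᵇ-∧-not {p = full} (allFin n)) countB-full

  countB<n : ∀ (S : VSet n) i → ¬ T (S i) → countB S < n
  countB<n {n} S i i∉S = begin-strict
    countB S                     <⟨ m<m+n (countB S) (∈⇒countᵇ>0 (∈-allFin i) i∈Sᶜ) ⟩
    countB S + countB (not ∘ S)  ≡⟨ countB+countB-not≡n S ⟩
    n                            ∎
    where
    open ≤-Reasoning
    i∈Sᶜ : T (not (S i))
    i∈Sᶜ with S i
    ... | false = _
    ... | true  = i∉S _

  size≡countB : ∀ (S : VSet n) → size S ≡ countB S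
  size≡countB {n} S = length-filter (allFin n)
    where
    length-filter : ∀ xs → length (concatMap (λ v → if S v then [ v ] else []) xs) ≡ countᵇ S xs
    length-filter []       = refl
    length-filter (x ∷ xs) with S x
    ... | true  = cong suc (length-filter xs)
    ... | false = length-filter xs

  ∣_∩_∣ : VSet n → VSet n → ℕ
  ∣ S ∩ A ∣ = countB (λ w → S w ∧ A w)

  ∣_∖_∣ : VSet n → VSet n → ℕ
  ∣ S ∖ A ∣ = countB (λ w → S w ∧ not (A w))

  ∣∩∣+∣∖∣≡countB : ∀ (S A : VSet n) → ∣ S ∩ A ∣ + ∣ S ∖ A ∣ ≡ countB S
  ∣∩∣+∣∖∣≡countB {n} S A = countᵇ-∧-not (allFin n)

  countSubsets : (VSet n → Bool) → ℕ
  countSubsets {n} P = countᵇ P (allSubsets n)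

  countSubsetsOfSize : ℕ → ℕ → ℕ
  countSubsetsOfSize n m = countSubsets {n} (λ S → countB S ≡ᵇ m)

  countSubsets-cong : ∀ {P Q : VSet n → Bool} → (∀ S → P S ≡ Q S) → countSubsets P ≡ countSubsets Q
  countSubsets-cong {n} P≗Q = countᵇ-cong P≗Q (allSubsets n)

  countSubsets-suc : ∀ (P : VSet (suc n) → Bool) →
    countSubsets P ≡ countSubsets (P ∘ extend false) + countSubsets (P ∘ extend true)
  countSubsets-suc {n} P = countᵇ-pairs P (extend false) (extend true) (allSubsets n)

  -- Hypergeometric counts

  meets? : VSet n → ℕ → ℕ → VSet n → Bool
  meets? A j i S = (∣ S ∩ A ∣ ≡ᵇ j) ∧ (∣ S ∖ A ∣ ≡ᵇ i)

  countSubsets-meets? : ∀ (A : VSet n) j i → countSubsets (meets? A j i) ≡ (countB A C j) * (countB (not ∘ A) C i)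
  countSubsets-meets? {zero}  A zero    zero    = refl
  countSubsets-meets? {zero}  A zero    (suc i) = refl
  countSubsets-meets? {zero}  A (suc j) i       = refl
  countSubsets-meets? {suc n} A j i = begin
    countSubsets (meets? A j i)
      ≡⟨ countSubsets-suc (meets? A j i) ⟩
    countSubsets (meets? A j i ∘ extend false) + countSubsets (meets? A j i ∘ extend true)
      ≡⟨ cong₂ _+_ (countSubsets-cong (first false)) (countSubsets-cong (first true)) ⟩
    countSubsets (meets? A′ j i) + countSubsets (meets-with (A zero) j i)
      ≡⟨ split-on-first (A zero) j i ⟩
    ((ind (A zero) + k) C j) * ((ind (not (A zero)) + l) C i)
      ≡⟨ sym (cong₂ (λ k l → (k C j) * (l C i)) (countB-suc A) (countB-suc (not ∘ A))) ⟩
    (countB A C j) * (countB (not ∘ A) C i) ∎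
    where
    open ≡-Reasoning
    ind : Bool → ℕ
    ind b = if b then 1 else 0
    A′ = A ∘ suc
    k = countB A′
    l = countB (not ∘ A′)
    meets-with : Bool → ℕ → ℕ → VSet n → Bool
    meets-with a j i S = ((ind a + ∣ S ∩ A′ ∣) ≡ᵇ j) ∧ ((ind (not a) + ∣ S ∖ A′ ∣) ≡ᵇ i)
    first : ∀ b S → meets? A j i (extend b S)
                    ≡ ((ind (b ∧ A zero) + ∣ S ∩ A′ ∣) ≡ᵇ j) ∧ ((ind (b ∧ not (A zero)) + ∣ S ∖ A′ ∣) ≡ᵇ i)
    first b S = cong₂ (λ x y → (x ≡ᵇ j) ∧ (y ≡ᵇ i))
                      (countB-suc (λ w → extend b S w ∧ A w)) (countB-suc (λ w → extend b S w ∧ not (A w)))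
    split-on-first : ∀ a j i →
      countSubsets (meets? A′ j i) + countSubsets (meets-with a j i) ≡ ((ind a + k) C j) * ((ind (not a) + l) C i)
    split-on-first true zero i =
      trans (cong (countSubsets (meets? A′ 0 i) +_) (countᵇ-false (allSubsets n)))
            (trans (+-identityʳ _) (countSubsets-meets? A′ 0 i))
    split-on-first true (suc j) i =
      trans (cong₂ _+_ (countSubsets-meets? A′ (suc j) i) (countSubsets-meets? A′ j i)) (pascal-*ʳ k j (l C i))
    split-on-first false j zero =
      trans (cong₂ _+_ (countSubsets-meets? A′ j 0)
                       (trans (countSubsets-cong (λ S → ∧-zeroʳ (∣ S ∩ A′ ∣ ≡ᵇ j))) (countᵇ-false (allSubsets n))))
            (+-identityʳ _)
    split-on-first false j (suc i) =
      trans (cong₂ _+_ (countSubsets-meets? A′ j (suc i)) (countSubsets-meets? A′ j i)) (pascal-*ˡ l i (k C j))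

  hypergeometric : VSet n → ℕ → ℕ → ℕ
  hypergeometric A m j = (countB A C j) * (countB (not ∘ A) C (m ∸ j))

  countSubsets-size∧∩≤hypergeometric : ∀ (A : VSet n) m j →
    countSubsets (λ S → (countB S ≡ᵇ m) ∧ (∣ S ∩ A ∣ ≡ᵇ j)) ≤ hypergeometric A m j
  countSubsets-size∧∩≤hypergeometric {n} A m j = begin
    countSubsets (λ S → (countB S ≡ᵇ m) ∧ (∣ S ∩ A ∣ ≡ᵇ j))  ≤⟨ countᵇ-mono rest-outside-A (allSubsets n) ⟩
    countSubsets (meets? A j (m ∸ j))                         ≡⟨ countSubsets-meets? A j (m ∸ j) ⟩
    hypergeometric A m j                                      ∎
    where
    open ≤-Reasoning
    rest-outside-A : ∀ S → T ((countB S ≡ᵇ m) ∧ (∣ S ∩ A ∣ ≡ᵇ j)) → T (meets? A j (m ∸ j) S)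
    rest-outside-A S h =
      let (size≡m , ∩≡j) = Equivalence.to (T-∧ {countB S ≡ᵇ m} {∣ S ∩ A ∣ ≡ᵇ j}) h
      in Equivalence.from (T-∧ {∣ S ∩ A ∣ ≡ᵇ j}) (∩≡j , ≡⇒≡ᵇ ∣ S ∖ A ∣ (m ∸ j) (begin-equality
        ∣ S ∖ A ∣                          ≡⟨ sym (m+n∸m≡n ∣ S ∩ A ∣ ∣ S ∖ A ∣) ⟩
        ∣ S ∩ A ∣ + ∣ S ∖ A ∣ ∸ ∣ S ∩ A ∣  ≡⟨ cong₂ _∸_ (trans (∣∩∣+∣∖∣≡countB S A) (≡ᵇ⇒≡ (countB S) m size≡m))
                                                        (≡ᵇ⇒≡ ∣ S ∩ A ∣ j ∩≡j) ⟩
        m ∸ j                              ∎))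

  hypergeometric≤countSubsetsOfSize : ∀ (A : VSet n) {m j} → j ≤ m → hypergeometric A m j ≤ countSubsetsOfSize n m
  hypergeometric≤countSubsetsOfSize {n} A {m} {j} j≤m = begin
    hypergeometric A m j               ≡⟨ sym (countSubsets-meets? A j (m ∸ j)) ⟩
    countSubsets (meets? A j (m ∸ j))  ≤⟨ countᵇ-mono size≡m (allSubsets n) ⟩
    countSubsetsOfSize n m             ∎
    where
    open ≤-Reasoning
    size≡m : ∀ S → T (meets? A j (m ∸ j) S) → T (countB S ≡ᵇ m)
    size≡m S h =
      let (∩≡j , ∖≡m-j) = Equivalence.to (T-∧ {∣ S ∩ A ∣ ≡ᵇ j}) h
      in ≡⇒≡ᵇ (countB S) m (begin-equality
        countB S               ≡⟨ sym (∣∩∣+∣∖∣≡countB S A) ⟩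
        ∣ S ∩ A ∣ + ∣ S ∖ A ∣  ≡⟨ cong₂ _+_ (≡ᵇ⇒≡ ∣ S ∩ A ∣ j ∩≡j) (≡ᵇ⇒≡ ∣ S ∖ A ∣ (m ∸ j) ∖≡m-j) ⟩
        j + (m ∸ j)            ≡⟨ m+[n∸m]≡n j≤m ⟩
        m                      ∎)

  countSubsetsOfSize>0 : ∀ {n m} → m ≤ n → 0 < countSubsetsOfSize n m
  countSubsetsOfSize>0 {n} {m} m≤n = begin-strict
    0                                  <⟨ k≤n⇒nCk>0 m≤n ⟩
    n C m                              ≡⟨ sym (*-identityʳ (n C m)) ⟩
    (n C m) * (0 C 0)                  ≡⟨ cong (λ i → (n C m) * (0 C i)) (sym (n∸n≡0 m)) ⟩
    (n C m) * (0 C (m ∸ m))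
      ≡⟨ sym (cong₂ (λ k l → (k C m) * (l C (m ∸ m))) countB-full (countᵇ-false (allFin n))) ⟩
    hypergeometric (full {n}) m m      ≤⟨ hypergeometric≤countSubsetsOfSize (full {n}) {m} ≤-refl ⟩
    countSubsetsOfSize n m             ∎
    where open ≤-Reasoning

  cross-multiply-≤ : ∀ {a b c d P Q} → 0 < P → a * P ≡ b * Q → c * Q ≤ d * P → c * a ≤ d * b
  cross-multiply-≤ {a} {b} {c} {d} {P} {Q} P>0 aP≡bQ cQ≤dP =
    *-cancelʳ-≤ (c * a) (d * b) P {{>-nonZero P>0}} (begin
      c * a * P    ≡⟨ *-assoc c a P ⟩
      c * (a * P)  ≡⟨ cong (c *_) aP≡bQ ⟩
      c * (b * Q)  ≡⟨ x∙yz≡y∙xz c b Q ⟩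
      b * (c * Q)  ≤⟨ *-monoʳ-≤ b cQ≤dP ⟩
      b * (d * P)  ≡⟨ x∙yz≡y∙xz b d P ⟩
      d * (b * P)  ≡⟨ sym (*-assoc d b P) ⟩
      d * b * P    ∎)
    where
    open ≤-Reasoning
    x∙yz≡y∙xz : ∀ x y z → x * (y * z) ≡ y * (x * z)
    x∙yz≡y∙xz x y z = solve 3 (λ x y z → x :* (y :* z) := y :* (x :* z)) refl x y z

  geometric-growth : ∀ x (f : ℕ → ℕ) j D → (∀ i → j ≤ i → i < j + D → suc x * f i ≤ x * f (suc i)) →
                     suc x ^ D * f j ≤ x ^ D * f (j + D)
  geometric-growth x f j zero    step rewrite +-identityʳ j = ≤-refl
  geometric-growth x f j (suc D) step = begin
    suc x ^ suc D * f j
      ≡⟨ solve 3 (λ y p a → (y :* p) :* a := p :* (y :* a)) refl (suc x) (suc x ^ D) (f j) ⟩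
    suc x ^ D * (suc x * f j)
      ≤⟨ *-monoʳ-≤ (suc x ^ D) (step j ≤-refl (m<m+n j z<s)) ⟩
    suc x ^ D * (x * f (suc j))
      ≡⟨ solve 3 (λ y p a → p :* (y :* a) := y :* (p :* a)) refl x (suc x ^ D) (f (suc j)) ⟩
    x * (suc x ^ D * f (suc j))
      ≤⟨ *-monoʳ-≤ x (geometric-growth x f (suc j) D step′) ⟩
    x * (x ^ D * f (suc j + D))
      ≡⟨ sym (*-assoc x (x ^ D) _) ⟩
    x ^ suc D * f (suc j + D)
      ≡⟨ cong (λ i → x ^ suc D * f i) (sym (+-suc j D)) ⟩
    x ^ suc D * f (j + suc D) ∎
    where
    open ≤-Reasoning
    step′ : ∀ i → suc j ≤ i → i < suc j + D → suc x * f i ≤ x * f (suc i)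
    step′ i j<i i<j+1+D = step i (<⇒≤ j<i) (≤-trans i<j+1+D (≤-reflexive (sym (+-suc j D))))

  balance⇒ratio : ∀ x {P Q α β} → P + α ≡ Q + β → P + suc x * α ≤ suc x * β → suc x * Q ≤ x * P
  balance⇒ratio x {P} {Q} {α} {β} balance P+cα≤cβ = +-cancelʳ-≤ P _ _ (begin
    suc x * Q + P  ≤⟨ +-cancelʳ-≤ (suc x * α) _ _ (begin
      suc x * Q + P + suc x * α    ≡⟨ +-assoc (suc x * Q) P (suc x * α) ⟩
      suc x * Q + (P + suc x * α)  ≤⟨ +-monoʳ-≤ (suc x * Q) P+cα≤cβ ⟩
      suc x * Q + suc x * β        ≡⟨ sym (*-distribˡ-+ (suc x) Q β) ⟩
      suc x * (Q + β)              ≡⟨ cong (suc x *_) (sym balance) ⟩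
      suc x * (P + α)              ≡⟨ *-distribˡ-+ (suc x) P α ⟩
      suc x * P + suc x * α        ∎) ⟩
    suc x * P      ≡⟨ +-comm P (x * P) ⟩
    x * P + P      ∎)
    where open ≤-Reasoning

  hypergeometric-step-identity : ∀ k l m i → i < m →
    (k C i) * (l C (m ∸ i)) * ((k ∸ i) * (m ∸ i)) ≡ (k C suc i) * (l C (m ∸ suc i)) * (suc i * (l ∸ (m ∸ suc i)))
  hypergeometric-step-identity k l m i i<m rewrite +-∸-assoc 1 i<m = begin
    a * b * ((k ∸ i) * suc v)
      ≡⟨ solve 4 (λ a b p q → a :* b :* (p :* q) := (a :* p) :* (b :* q)) refl a b (k ∸ i) (suc v) ⟩
    (a * (k ∸ i)) * (b * suc v)
      ≡⟨ cong₂ _*_ (sym (nC[1+k]*[1+k]≡nCk*[n∸k] k i)) (nC[1+k]*[1+k]≡nCk*[n∸k] l v) ⟩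
    (c * suc i) * (d * (l ∸ v))
      ≡⟨ solve 4 (λ c d p q → (c :* p) :* (d :* q) := c :* d :* (p :* q)) refl c d (suc i) (l ∸ v) ⟩
    c * d * (suc i * (l ∸ v)) ∎
    where
    open ≡-Reasoning
    v = m ∸ suc i
    a = k C i
    b = l C suc v
    c = k C suc i
    d = l C v

  -- P = (u+1)(v+1) and Q = (i+1)t balance as P + α ≡ Q + β, and P + 2hα ≤ 2hβ adds up four
  -- estimates: P ≤ km, 2h·in ≤ 2h·km - 2km, 2h·n ≤ km and 2i + 1 ≤ k + m.
  hypergeometric-ratio-bound : ∀ {h x} → suc x ≡ 2 * h → ∀ {i u v t k m n} →
    k ≡ i + suc u → m ≡ i + suc v → n ≡ k + (v + t) →
    n ≤ 2 * m → 8 * h ≤ k → h * n * i + m * k ≤ h * m * k →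
    suc x * (suc i * t) ≤ x * (suc u * suc v)
  hypergeometric-ratio-bound {h} {x} x+1≡2h {i} {u} {v} {t} {k} {m} {n} refl refl refl n≤2m 8h≤k steep =
    balance⇒ratio x balance (+-cancelʳ-≤ (2 * (k * m)) _ _ (begin
      P + suc x * α + 2 * (k * m)
        ≡⟨ cong (λ c → P + c * α + 2 * (k * m)) x+1≡2h ⟩
      P + 2 * h * α + 2 * (k * m)
        ≡⟨ solve 6 (λ P h i n k m → P :+ con 2 :* h :* (i :* n :+ n :+ con 2 :* i :+ con 1) :+ con 2 :* (k :* m)
              := P :+ (con 2 :* h :* (i :* n) :+ con 2 :* (k :* m)) :+ con 2 :* h :* n :+ con 2 :* h :* (con 2 :* i :+ con 1))
             refl P h i n k m ⟩
      P + (2 * h * (i * n) + 2 * (k * m)) + 2 * h * n + 2 * h * (2 * i + 1)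
        ≤⟨ +-mono-≤ (+-mono-≤ (+-mono-≤ P≤km 2hin+2km≤2hkm) 2hn≤km) (*-monoʳ-≤ (2 * h) 2i+1≤k+m) ⟩
      k * m + 2 * h * (k * m) + k * m + 2 * h * (k + m)
        ≡⟨ solve 3 (λ h k m → k :* m :+ con 2 :* h :* (k :* m) :+ k :* m :+ con 2 :* h :* (k :+ m)
              := con 2 :* h :* (k :* m :+ k :+ m) :+ con 2 :* (k :* m)) refl h k m ⟩
      2 * h * β + 2 * (k * m)
        ≡⟨ cong (λ c → c * β + 2 * (k * m)) (sym x+1≡2h) ⟩
      suc x * β + 2 * (k * m) ∎))
    where
    open ≤-Reasoning
    P = suc u * suc v
    α = i * n + n + 2 * i + 1
    β = k * m + k + m
    balance : P + α ≡ suc i * t + β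
    balance = solve 4 (λ i u v t →
       (con 1 :+ u) :* (con 1 :+ v) :+ (i :* ((i :+ (con 1 :+ u)) :+ (v :+ t)) :+ ((i :+ (con 1 :+ u)) :+ (v :+ t))
                                        :+ con 2 :* i :+ con 1)
       := (con 1 :+ i) :* t :+ ((i :+ (con 1 :+ u)) :* (i :+ (con 1 :+ v)) :+ (i :+ (con 1 :+ u)) :+ (i :+ (con 1 :+ v))))
      refl i u v t
    P≤km : P ≤ k * m
    P≤km = *-mono-≤ (m≤n+m (suc u) i) (m≤n+m (suc v) i)
    2hin+2km≤2hkm : 2 * h * (i * n) + 2 * (k * m) ≤ 2 * h * (k * m)
    2hin+2km≤2hkm = begin
      2 * h * (i * n) + 2 * (k * m)
        ≡⟨ solve 5 (λ h i n k m → con 2 :* h :* (i :* n) :+ con 2 :* (k :* m) := con 2 :* (h :* n :* i :+ m :* k))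
                   refl h i n k m ⟩
      2 * (h * n * i + m * k)  ≤⟨ *-monoʳ-≤ 2 steep ⟩
      2 * (h * m * k)          ≡⟨ solve 3 (λ h m k → con 2 :* (h :* m :* k) := con 2 :* h :* (k :* m)) refl h m k ⟩
      2 * h * (k * m)          ∎
    2hn≤km : 2 * h * n ≤ k * m
    2hn≤km = *-cancelˡ-≤ 4 (begin
      4 * (2 * h * n)  ≡⟨ solve 2 (λ h n → con 4 :* (con 2 :* h :* n) := con 8 :* h :* n) refl h n ⟩
      8 * h * n        ≤⟨ *-monoˡ-≤ n 8h≤k ⟩
      k * n            ≤⟨ *-monoʳ-≤ k n≤2m ⟩
      k * (2 * m)      ≤⟨ *-monoʳ-≤ k (*-monoˡ-≤ m (s≤s (s≤s (z≤n {2})))) ⟩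
      k * (4 * m)      ≡⟨ solve 2 (λ k m → k :* (con 4 :* m) := con 4 :* (k :* m)) refl k m ⟩
      4 * (k * m)      ∎)
    2i+1≤k+m : 2 * i + 1 ≤ k + m
    2i+1≤k+m = begin
      2 * i + 1    ≡⟨ solve 1 (λ i → con 2 :* i :+ con 1 := (i :+ con 1) :+ i) refl i ⟩
      (i + 1) + i  ≤⟨ +-mono-≤ (+-monoʳ-≤ i (s≤s z≤n)) (m≤m+n i (suc v)) ⟩
      k + m        ∎

  hypergeometric-step : ∀ {h x} → suc x ≡ 2 * h → ∀ {k l m n} → k + l ≡ n → m ≤ n → n ≤ 2 * m → 8 * h ≤ k →
    ∀ i → h * n * i + m * k < h * m * k →
    suc x * ((k C i) * (l C (m ∸ i))) ≤ x * ((k C suc i) * (l C (m ∸ suc i)))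
  hypergeometric-step {h} {x} x+1≡2h {k} {l} {m} refl m≤n n≤2m 8h≤k i steep =
    cross-multiply-≤ {(k C i) * (l C (m ∸ i))} {(k C suc i) * (l C (m ∸ suc i))} {suc x} {x}
      P>0 (hypergeometric-step-identity k l m i i<m) ratio-step
    where
    hni<hmk : h * (k + l) * i < h * m * k
    hni<hmk = ≤-<-trans (m≤m+n _ (m * k)) steep
    i<k : i < k
    i<k = *-cancelˡ-< (h * (k + l)) i k (begin-strict
      h * (k + l) * i  <⟨ hni<hmk ⟩
      h * m * k        ≤⟨ *-monoˡ-≤ k (*-monoʳ-≤ h m≤n) ⟩
      h * (k + l) * k  ∎)
      where open ≤-Reasoning
    i<m : i < m
    i<m = *-cancelˡ-< (h * (k + l)) i m (begin-strict
      h * (k + l) * i  <⟨ hni<hmk ⟩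
      h * m * k        ≤⟨ *-monoʳ-≤ (h * m) (m≤m+n k l) ⟩
      h * m * (k + l)  ≡⟨ solve 3 (λ h m n → h :* m :* n := h :* n :* m) refl h m (k + l) ⟩
      h * (k + l) * m  ∎)
      where open ≤-Reasoning
    u = k ∸ suc i
    v = m ∸ suc i
    k∸i≡1+u : k ∸ i ≡ suc u
    k∸i≡1+u = +-∸-assoc 1 i<k
    m∸i≡1+v : m ∸ i ≡ suc v
    m∸i≡1+v = +-∸-assoc 1 i<m
    P>0 : 0 < (k ∸ i) * (m ∸ i)
    P>0 rewrite k∸i≡1+u | m∸i≡1+v = z<s
    ratio-step : suc x * (suc i * (l ∸ v)) ≤ x * ((k ∸ i) * (m ∸ i))
    ratio-step rewrite k∸i≡1+u | m∸i≡1+v with v ≤? l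
    ... | yes v≤l = hypergeometric-ratio-bound {h} x+1≡2h
          (sym (trans (+-suc i u) (m+[n∸m]≡n i<k))) (sym (trans (+-suc i v) (m+[n∸m]≡n i<m)))
          (cong (k +_) (sym (m+[n∸m]≡n v≤l))) n≤2m 8h≤k (<⇒≤ steep)
    ... | no v≰l rewrite m≤n⇒m∸n≡0 (<⇒≤ (≰⇒> v≰l)) | *-zeroʳ (suc i) | *-zeroʳ (suc x) = z≤n

  -- Vertices with few neighbours in S

  -- low? E n m δ j says j < (1 - 1/E)·(m/n)·δ, with the denominators cleared.
  low? : ℕ → ℕ → ℕ → ℕ → ℕ → Bool
  low? E n m δ j = E * n * j + m * δ <ᵇ E * m * δ

  -- Below (1 - 1/(2E))·mk/n consecutive hypergeometric terms grow, and a low j stays there for D steps.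
  low⇒steep : ∀ {E n m δ k D j} → E * n * j + m * δ < E * m * δ → δ ≤ k → 4 * E * D ≤ δ → n ≤ 2 * m →
              2 * E * n * (j + D) + m * k < 2 * E * m * k
  low⇒steep {suc e} {n} {m} {δ} {k} {D} {j} low δ≤k 4ED≤δ n≤2m = begin-strict
    2 * E * n * (j + D) + m * k
      ≡⟨ solve 6 (λ E n j D m k → con 2 :* E :* n :* (j :+ D) :+ m :* k
                   := con 2 :* E :* n :* D :+ con 2 :* (E :* n :* j) :+ m :* k) refl E n j D m k ⟩
    2 * E * n * D + 2 * (E * n * j) + m * k
      ≤⟨ +-monoˡ-≤ (m * k) (+-monoˡ-≤ _ 2EnD≤mk) ⟩
    m * k + 2 * (E * n * j) + m * k
      ≡⟨ solve 2 (λ a b → b :+ con 2 :* a :+ b := con 2 :* (a :+ b)) refl (E * n * j) (m * k) ⟩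
    2 * (E * n * j + m * k)
      <⟨ *-monoʳ-< 2 Enj+mk<Emk ⟩
    2 * (E * m * k)
      ≡⟨ solve 3 (λ E m k → con 2 :* (E :* m :* k) := con 2 :* E :* m :* k) refl E m k ⟩
    2 * E * m * k ∎
    where
    open ≤-Reasoning
    E = suc e
    Enj<emδ : E * n * j < e * m * δ
    Enj<emδ = +-cancelʳ-< (m * δ) _ _ (<-≤-trans low (≤-reflexive
      (solve 3 (λ e m δ → (con 1 :+ e) :* m :* δ := e :* m :* δ :+ m :* δ) refl e m δ)))
    Enj+mk<Emk : E * n * j + m * k < E * m * k
    Enj+mk<Emk = begin-strict
      E * n * j + m * k  <⟨ +-monoˡ-< (m * k) Enj<emδ ⟩
      e * m * δ + m * k  ≤⟨ +-monoˡ-≤ (m * k) (*-monoʳ-≤ (e * m) δ≤k) ⟩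
      e * m * k + m * k  ≡⟨ solve 3 (λ e m k → e :* m :* k :+ m :* k := (con 1 :+ e) :* m :* k) refl e m k ⟩
      E * m * k          ∎
    2EnD≤mk : 2 * E * n * D ≤ m * k
    2EnD≤mk = *-cancelˡ-≤ 2 (begin
      2 * (2 * E * n * D)  ≡⟨ solve 3 (λ E n D → con 2 :* (con 2 :* E :* n :* D) := con 4 :* E :* D :* n) refl E n D ⟩
      4 * E * D * n        ≤⟨ *-monoˡ-≤ n (≤-trans 4ED≤δ δ≤k) ⟩
      k * n                ≤⟨ *-monoʳ-≤ k n≤2m ⟩
      k * (2 * m)          ≡⟨ solve 2 (λ k m → k :* (con 2 :* m) := con 2 :* (m :* k)) refl k m ⟩
      2 * (m * k)          ∎)

  low-value-bound : ∀ {E x D} → suc x ≡ 2 * (2 * E) → ∀ {n m δ j} (A : VSet n) →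
    δ ≤ countB A → 16 * E ≤ δ → 4 * E * D ≤ δ → m ≤ n → n ≤ 2 * m → T (low? E n m δ j) →
    suc x ^ D * countSubsets (λ S → (countB S ≡ᵇ m) ∧ (∣ S ∩ A ∣ ≡ᵇ j)) ≤ x ^ D * countSubsetsOfSize n m
  low-value-bound {E} {x} {D} x+1≡4E {n} {m} {δ} {j} A δ≤k 16E≤δ 4ED≤δ m≤n n≤2m low = begin
    suc x ^ D * countSubsets (λ S → (countB S ≡ᵇ m) ∧ (∣ S ∩ A ∣ ≡ᵇ j))
      ≤⟨ *-monoʳ-≤ (suc x ^ D) (countSubsets-size∧∩≤hypergeometric A m j) ⟩
    suc x ^ D * hypergeometric A m j
      ≤⟨ geometric-growth x (hypergeometric A m) j D (λ i _ i<j+D →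
           hypergeometric-step {2 * E} x+1≡4E (countB+countB-not≡n A) m≤n n≤2m 8h≤k i
             (≤-<-trans (+-monoˡ-≤ (m * k) (*-monoʳ-≤ (2 * E * n) (<⇒≤ i<j+D))) steep)) ⟩
    x ^ D * hypergeometric A m (j + D)
      ≤⟨ *-monoʳ-≤ (x ^ D) (hypergeometric≤countSubsetsOfSize A j+D≤m) ⟩
    x ^ D * countSubsetsOfSize n m ∎
    where
    open ≤-Reasoning
    k = countB A
    steep : 2 * E * n * (j + D) + m * k < 2 * E * m * k
    steep = low⇒steep {E} {n} {m} {δ} {k} {D} {j} (<ᵇ⇒< (E * n * j + m * δ) (E * m * δ) low) δ≤k 4ED≤δ n≤2m
    8h≤k : 8 * (2 * E) ≤ k
    8h≤k = ≤-trans (≤-reflexive (solve 1 (λ E → con 8 :* (con 2 :* E) := con 16 :* E) refl E)) (≤-trans 16E≤δ δ≤k)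
    j+D≤m : j + D ≤ m
    j+D≤m = <⇒≤ (*-cancelˡ-< (2 * E * n) (j + D) m (begin-strict
      2 * E * n * (j + D)          ≤⟨ m≤m+n _ (m * k) ⟩
      2 * E * n * (j + D) + m * k  <⟨ steep ⟩
      2 * E * m * k                ≤⟨ *-monoʳ-≤ (2 * E * m) (countB≤n A) ⟩
      2 * E * m * n                ≡⟨ solve 3 (λ h m n → h :* m :* n := h :* n :* m) refl (2 * E) m n ⟩
      2 * E * n * m                ∎))

  low-subsets-bound : ∀ {E x D} → suc x ≡ 2 * (2 * E) → ∀ {n m δ} (A : VSet n) →
    δ ≤ countB A → 16 * E ≤ δ → 4 * E * D ≤ δ → m ≤ n → n ≤ 2 * m →
    suc x ^ D * countSubsets (λ S → (countB S ≡ᵇ m) ∧ low? E n m δ ∣ S ∩ A ∣) ≤ suc n * (x ^ D * countSubsetsOfSize n m)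
  low-subsets-bound {E} {x} {D} x+1≡4E {n} {m} {δ} A δ≤k 16E≤δ 4ED≤δ m≤n n≤2m = begin
    suc x ^ D * countSubsets (λ S → (countB S ≡ᵇ m) ∧ low? E n m δ ∣ S ∩ A ∣)
      ≤⟨ *-monoʳ-≤ (suc x ^ D) (≤-trans (countᵇ-mono by-value (allSubsets n))
                                        (countᵇ-∧-any (λ _ → true) q (upTo (suc n)) (allSubsets n))) ⟩
    suc x ^ D * sum (map (countSubsets ∘ q) (upTo (suc n)))
      ≤⟨ c*sum≤length*d (suc x ^ D) (x ^ D * Tot) (countSubsets ∘ q) per-value (upTo (suc n)) ⟩
    length (upTo (suc n)) * (x ^ D * Tot)
      ≡⟨ cong (_* (x ^ D * Tot)) (length-upTo (suc n)) ⟩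
    suc n * (x ^ D * Tot) ∎
    where
    open ≤-Reasoning
    Tot = countSubsetsOfSize n m
    -- low? j comes first, so that q j reduces to the constant false when j is not low.
    q : ℕ → VSet n → Bool
    q j S = low? E n m δ j ∧ ((countB S ≡ᵇ m) ∧ (∣ S ∩ A ∣ ≡ᵇ j))
    by-value : ∀ S → T ((countB S ≡ᵇ m) ∧ low? E n m δ ∣ S ∩ A ∣) → T (any (λ j → q j S) (upTo (suc n)))
    by-value S h =
      let (size≡m , low) = Equivalence.to (T-∧ {countB S ≡ᵇ m} {low? E n m δ ∣ S ∩ A ∣}) h
          q-at : ∀ {j} → ∣ S ∩ A ∣ ≡ j → T (q j S)
          q-at = λ { refl → Equivalence.from (T-∧ {low? E n m δ ∣ S ∩ A ∣})
                     (low , Equivalence.from (T-∧ {countB S ≡ᵇ m}) (size≡m , ≡⇒≡ᵇ ∣ S ∩ A ∣ ∣ S ∩ A ∣ refl)) }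
      in any⁺ (λ j → q j S) (Any.map q-at (∈-upTo⁺ (s≤s (countB≤n (λ w → S w ∧ A w)))))
    per-value : ∀ j → suc x ^ D * countSubsets (λ S → low? E n m δ j ∧ ((countB S ≡ᵇ m) ∧ (∣ S ∩ A ∣ ≡ᵇ j)))
                      ≤ x ^ D * Tot
    per-value j with low? E n m δ j in low
    ... | true  = low-value-bound {E} {x} {D} x+1≡4E {j = j} A δ≤k 16E≤δ 4ED≤δ m≤n n≤2m (subst T (sym low) _)
    ... | false = ≤-trans (≤-reflexive (trans (cong (suc x ^ D *_) (countᵇ-false (allSubsets n)))
                                              (*-zeroʳ (suc x ^ D))))
                          z≤n

  minList-≤ : ∀ {x xs} → x ∈ xs → minList xs ≤ x
  minList-≤ {xs = x ∷ []}     (here refl) = ≤-refl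
  minList-≤ {xs = x ∷ y ∷ xs} (here refl) = m⊓n≤m x _
  minList-≤ {xs = x ∷ y ∷ xs} (there x∈) = ≤-trans (m⊓n≤n x _) (minList-≤ x∈)

  minList-∈ : ∀ x xs → minList (x ∷ xs) ∈ x ∷ xs
  minList-∈ x []       = here refl
  minList-∈ x (y ∷ xs) with ⊓-sel x (minList (y ∷ xs))
  ... | inj₁ x⊓m≡x = here x⊓m≡x
  ... | inj₂ x⊓m≡m = there (subst (_∈ y ∷ xs) (sym x⊓m≡m) (minList-∈ y xs))

  minList-map-attained : ∀ (f : A → ℕ) xs → 0 < length xs → ∃[ x ] minList (map f xs) ≡ f x
  minList-map-attained f (x ∷ xs) _ =
    let (y , _ , min≡fy) = ∈-map⁻ f (minList-∈ (f x) (map f xs)) in y , min≡fy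

  ∈-verts-full : ∀ (v : Fin n) → v ∈ verts (full {n})
  ∈-verts-full {n} v = subst (v ∈_) (sym (concatMap-pure (allFin n))) (∈-allFin v)

  δ⁺≤outdeg : ∀ (G : Digraph n) v → δ⁺ G ≤ countB (adj G v)
  δ⁺≤outdeg G v = minList-≤ (∈-map⁺ (outdegIn G full) (∈-verts-full v))

  δ⁻≤indeg : ∀ (G : Digraph n) v → δ⁻ G ≤ countB (λ w → adj G w v)
  δ⁻≤indeg G v = minList-≤ (∈-map⁺ (indegIn G full) (∈-verts-full v))

  -- Good subsets

  low-at? : ℕ → Digraph n → ℕ → Fin n → VSet n → Bool
  low-at? {n} E G m v S = low? E n m (δ⁺ G) ∣ S ∩ adj G v ∣ ∨ low? E n m (δ⁻ G) ∣ S ∩ (λ w → adj G w v) ∣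

  deficient? : ℕ → Digraph n → ℕ → VSet n → Bool
  deficient? {n} E G m S = any (λ v → low-at? E G m v S) (allFin n)

  good? : ℕ → Digraph n → ℕ → VSet n → Bool
  good? E G m S = (countB S ≡ᵇ m) ∧ not (deficient? E G m S)

  low-at-subsets-bound : ∀ {E x D n m} (G : Digraph n) → suc x ≡ 2 * (2 * E) →
    16 * E ≤ δ⁺ G ⊓ δ⁻ G → 4 * E * D ≤ δ⁺ G ⊓ δ⁻ G → m ≤ n → n ≤ 2 * m → ∀ v →
    suc x ^ D * countSubsets (λ S → (countB S ≡ᵇ m) ∧ low-at? E G m v S) ≤ 2 * (suc n * (x ^ D * countSubsetsOfSize n m))
  low-at-subsets-bound {E} {x} {D} {n} {m} G x+1≡4E 16E≤δ 4ED≤δ m≤n n≤2m v = begin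
    suc x ^ D * countSubsets (λ S → size≡m S ∧ (out-low S ∨ in-low S))
      ≡⟨ cong (suc x ^ D *_) (countSubsets-cong (λ S → ∧-distribˡ-∨ (size≡m S) (out-low S) (in-low S))) ⟩
    suc x ^ D * countSubsets (λ S → (size≡m S ∧ out-low S) ∨ (size≡m S ∧ in-low S))
      ≤⟨ *-monoʳ-≤ (suc x ^ D) (countᵇ-∨ (allSubsets n)) ⟩
    suc x ^ D * (countSubsets (λ S → size≡m S ∧ out-low S) + countSubsets (λ S → size≡m S ∧ in-low S))
      ≡⟨ *-distribˡ-+ (suc x ^ D) _ _ ⟩
    suc x ^ D * countSubsets (λ S → size≡m S ∧ out-low S) + suc x ^ D * countSubsets (λ S → size≡m S ∧ in-low S)
      ≤⟨ +-mono-≤ (low-subsets-bound {E} {x} {D} x+1≡4E (adj G v) (δ⁺≤outdeg G v)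
                     (≤-trans 16E≤δ (m⊓n≤m _ _)) (≤-trans 4ED≤δ (m⊓n≤m _ _)) m≤n n≤2m)
                  (low-subsets-bound {E} {x} {D} x+1≡4E (λ w → adj G w v) (δ⁻≤indeg G v)
                     (≤-trans 16E≤δ (m⊓n≤n _ _)) (≤-trans 4ED≤δ (m⊓n≤n _ _)) m≤n n≤2m) ⟩
    suc n * (x ^ D * Tot) + suc n * (x ^ D * Tot)
      ≡⟨ solve 1 (λ a → a :+ a := con 2 :* a) refl (suc n * (x ^ D * Tot)) ⟩
    2 * (suc n * (x ^ D * Tot)) ∎
    where
    open ≤-Reasoning
    Tot = countSubsetsOfSize n m
    size≡m out-low in-low : VSet n → Bool
    size≡m S = countB S ≡ᵇ m
    out-low S = low? E n m (δ⁺ G) ∣ S ∩ adj G v ∣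
    in-low  S = low? E n m (δ⁻ G) ∣ S ∩ (λ w → adj G w v) ∣

  good-subset-exists : ∀ {E x D n m} (G : Digraph n) → suc x ≡ 2 * (2 * E) →
    16 * E ≤ δ⁺ G ⊓ δ⁻ G → 4 * E * D ≤ δ⁺ G ⊓ δ⁻ G → m ≤ n → n ≤ 2 * m → n * (2 * suc n) * x ^ D < suc x ^ D →
    Any (T ∘ good? E G m) (allSubsets n)
  good-subset-exists {E} {x} {D} {n} {m} G x+1≡4E 16E≤δ 4ED≤δ m≤n n≤2m gap =
    countᵇ>0⇒any (good? E G m) (allSubsets n) (+-cancelˡ-< Bad 0 Good (begin-strict
      Bad + 0     ≡⟨ +-identityʳ Bad ⟩
      Bad         <⟨ Bad<Tot ⟩
      Tot         ≡⟨ sym (countᵇ-∧-not (allSubsets n)) ⟩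
      Bad + Good  ∎))
    where
    open ≤-Reasoning
    size≡m : VSet n → Bool
    size≡m S = countB S ≡ᵇ m
    Tot Bad Good : ℕ
    Tot  = countSubsetsOfSize n m
    Bad  = countSubsets (λ S → size≡m S ∧ deficient? E G m S)
    Good = countSubsets (good? E G m)
    Bad<Tot : Bad < Tot
    Bad<Tot = *-cancelˡ-< (suc x ^ D) Bad Tot (begin-strict
      suc x ^ D * Bad
        ≤⟨ *-monoʳ-≤ (suc x ^ D) (countᵇ-∧-any size≡m (low-at? E G m) (allFin n) (allSubsets n)) ⟩
      suc x ^ D * sum (map (λ v → countSubsets (λ S → size≡m S ∧ low-at? E G m v S)) (allFin n))
        ≤⟨ c*sum≤length*d (suc x ^ D) _ _ (low-at-subsets-bound {E} {x} {D} G x+1≡4E 16E≤δ 4ED≤δ m≤n n≤2m) (allFin n) ⟩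
      length (allFin n) * (2 * (suc n * (x ^ D * Tot)))
        ≡⟨ cong (_* (2 * (suc n * (x ^ D * Tot)))) (length-tabulate {n = n} (λ i → i)) ⟩
      n * (2 * (suc n * (x ^ D * Tot)))
        ≡⟨ solve 3 (λ n a t → n :* (con 2 :* ((con 1 :+ n) :* (a :* t))) := n :* (con 2 :* (con 1 :+ n)) :* a :* t)
                   refl n (x ^ D) Tot ⟩
      n * (2 * suc n) * x ^ D * Tot
        <⟨ *-monoˡ-< Tot {{>-nonZero (countSubsetsOfSize>0 m≤n)}} gap ⟩
      suc x ^ D * Tot ∎)

  good-subset-exists-eventually : ∀ e b .{{_ : NonZero b}} → ∃[ n₀ ] 0 < n₀ ×
    ∀ {n a m} .{{_ : NonZero a}} (G : Digraph n) → n₀ ≤ n →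
    atLeastPow (δ⁺ G) n a b → atLeastPow (δ⁻ G) n a b → m ≤ n → n ≤ 2 * m →
    Any (T ∘ good? (suc e) G m) (allSubsets n)
  good-subset-exists-eventually e b = K ^ b , m^n>0 K {{>-nonZero K>0}} b , good
    where
    x = 3 + 4 * e
    window = window-length (suc e) x b
    K = proj₁ window
    K>0 = proj₁ (proj₂ window)
    x+1≡4E : suc x ≡ 2 * (2 * suc e)
    x+1≡4E = solve 1 (λ e → con 4 :+ con 4 :* e := con 2 :* (con 2 :* (con 1 :+ e))) refl e
    good : ∀ {n a m} .{{_ : NonZero a}} (G : Digraph n) → K ^ b ≤ n →
           atLeastPow (δ⁺ G) n a b → atLeastPow (δ⁻ G) n a b → m ≤ n → n ≤ 2 * m →
           Any (T ∘ good? (suc e) G m) (allSubsets n)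
    good G n₀≤n hp hm m≤n n≤2m =
      let n≤δᵇ = n≤[m⊓o]^b {b = b} {δ⁺ G} {δ⁻ G} hp hm
          (D , 16E≤δ , 4ED≤δ , gap) = proj₂ (proj₂ window) (^-cancelʳ-≤ b (≤-trans n₀≤n n≤δᵇ)) n≤δᵇ
      in good-subset-exists {suc e} {x} {D} G x+1≡4E 16E≤δ 4ED≤δ m≤n n≤2m gap

module _ where

  open import Data.Integer as ℤ using (+_)
  import Data.Integer.Properties as ℤ
  import Data.Integer.Solver as ℤ
  open import Data.Nat as ℕ using (ℕ; zero; suc; _≡ᵇ_)
  import Data.Nat.Properties as ℕ
  open import Data.Rational
  open import Data.Rational.Properties
  import Data.Rational.Solver as ℚ
  import Data.Rational.Unnormalised as ℚᵘ
  import Data.Rational.Unnormalised.Properties as ℚᵘ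

  -- The embedding of ℕ into ℚ

  toℚᵘ-/ : ∀ m k → toℚᵘ (+ m / suc k) ℚᵘ.≃ ℚᵘ.mkℚᵘ (+ m) k
  toℚᵘ-/ m k = toℚᵘ-fromℚᵘ (ℚᵘ.mkℚᵘ (+ m) k)

  toℚ-homo-+ : ∀ a b → toℚ (a ℕ.+ b) ≡ toℚ a + toℚ b
  toℚ-homo-+ a b = toℚᵘ-injective (begin
    toℚᵘ (toℚ (a ℕ.+ b))                  ≈⟨ toℚᵘ-/ (a ℕ.+ b) 0 ⟩
    ℚᵘ.mkℚᵘ (+ (a ℕ.+ b)) 0               ≈⟨ ℚᵘ.*≡* (trans (cong (ℤ._* + 1) (ℤ.pos-+ a b))
                                               (solve 2 (λ a b → (a :+ b) :* con (+ 1)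
                                                           := (a :* con (+ 1) :+ b :* con (+ 1)) :* con (+ 1))
                                                      refl (+ a) (+ b))) ⟩
    ℚᵘ.mkℚᵘ (+ a) 0 ℚᵘ.+ ℚᵘ.mkℚᵘ (+ b) 0   ≈⟨ ℚᵘ.≃-sym (ℚᵘ.+-cong (toℚᵘ-/ a 0) (toℚᵘ-/ b 0)) ⟩
    toℚᵘ (toℚ a) ℚᵘ.+ toℚᵘ (toℚ b)        ≈⟨ ℚᵘ.≃-sym (toℚᵘ-homo-+ (toℚ a) (toℚ b)) ⟩
    toℚᵘ (toℚ a + toℚ b)                  ∎)
    where
    open ℚᵘ.≃-Reasoning
    open ℤ.+-*-Solver

  toℚ-homo-* : ∀ a b → toℚ (a ℕ.* b) ≡ toℚ a * toℚ b
  toℚ-homo-* a b = toℚᵘ-injective (begin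
    toℚᵘ (toℚ (a ℕ.* b))                  ≈⟨ toℚᵘ-/ (a ℕ.* b) 0 ⟩
    ℚᵘ.mkℚᵘ (+ (a ℕ.* b)) 0               ≈⟨ ℚᵘ.*≡* (cong (ℤ._* + 1) (ℤ.pos-* a b)) ⟩
    ℚᵘ.mkℚᵘ (+ a) 0 ℚᵘ.* ℚᵘ.mkℚᵘ (+ b) 0   ≈⟨ ℚᵘ.≃-sym (ℚᵘ.*-cong (toℚᵘ-/ a 0) (toℚᵘ-/ b 0)) ⟩
    toℚᵘ (toℚ a) ℚᵘ.* toℚᵘ (toℚ b)        ≈⟨ ℚᵘ.≃-sym (toℚᵘ-homo-* (toℚ a) (toℚ b)) ⟩
    toℚᵘ (toℚ a * toℚ b)                  ∎)
    where open ℚᵘ.≃-Reasoning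

  ratio*n≡m : ∀ m k → ratio m (suc k) * toℚ (suc k) ≡ toℚ m
  ratio*n≡m m k = toℚᵘ-injective (begin
    toℚᵘ (ratio m (suc k) * toℚ (suc k))            ≈⟨ toℚᵘ-homo-* (ratio m (suc k)) (toℚ (suc k)) ⟩
    toℚᵘ (ratio m (suc k)) ℚᵘ.* toℚᵘ (toℚ (suc k))  ≈⟨ ℚᵘ.*-cong (toℚᵘ-/ m k) (toℚᵘ-/ (suc k) 0) ⟩
    ℚᵘ.mkℚᵘ (+ m) k ℚᵘ.* ℚᵘ.mkℚᵘ (+ suc k) 0        ≈⟨ ℚᵘ.*≡* (solve 2 (λ m n → (m :* n) :* con (+ 1) := m :* (n :* con (+ 1)))
                                                                       refl (+ m) (+ suc k)) ⟩
    ℚᵘ.mkℚᵘ (+ m) 0                                 ≈⟨ ℚᵘ.≃-sym (toℚᵘ-/ m 0) ⟩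
    toℚᵘ (toℚ m)                                    ∎)
    where
    open ℚᵘ.≃-Reasoning
    open ℤ.+-*-Solver

  toℚ-nonNeg : ∀ a → 0ℚ ≤ toℚ a
  toℚ-nonNeg a = nonNegative⁻¹ (toℚ a) {{normalize-nonNeg a 1}}

  toℚ-pos : ∀ a → 0ℚ < toℚ (suc a)
  toℚ-pos a = positive⁻¹ (toℚ (suc a)) {{normalize-pos (suc a) 1}}

  toℚ-mono-≤ : ∀ {a b} → a ℕ.≤ b → toℚ a ≤ toℚ b
  toℚ-mono-≤ {a} {b} a≤b = begin
    toℚ a                  ≡⟨ sym (+-identityʳ (toℚ a)) ⟩
    toℚ a + 0ℚ             ≤⟨ +-monoʳ-≤ (toℚ a) (toℚ-nonNeg (b ℕ.∸ a)) ⟩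
    toℚ a + toℚ (b ℕ.∸ a)  ≡⟨ sym (toℚ-homo-+ a (b ℕ.∸ a)) ⟩
    toℚ (a ℕ.+ (b ℕ.∸ a))  ≡⟨ cong toℚ (ℕ.m+[n∸m]≡n a≤b) ⟩
    toℚ b                  ∎
    where open ≤-Reasoning

  toℚ-mono-< : ∀ {a b} → a ℕ.< b → toℚ a < toℚ b
  toℚ-mono-< {a} {suc b} (ℕ.s≤s a≤b) = begin-strict
    toℚ a                        ≡⟨ sym (+-identityʳ (toℚ a)) ⟩
    toℚ a + 0ℚ                   <⟨ +-monoʳ-< (toℚ a) (toℚ-pos (b ℕ.∸ a)) ⟩
    toℚ a + toℚ (suc (b ℕ.∸ a))  ≡⟨ sym (toℚ-homo-+ a (suc (b ℕ.∸ a))) ⟩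
    toℚ (a ℕ.+ suc (b ℕ.∸ a))    ≡⟨ cong toℚ (trans (ℕ.+-suc a (b ℕ.∸ a)) (cong suc (ℕ.m+[n∸m]≡n a≤b))) ⟩
    toℚ (suc b)                  ∎
    where open ≤-Reasoning

  ratio>0 : ∀ {m k} → 0 ℕ.< m → 0ℚ < ratio m (suc k)
  ratio>0 {suc m} {k} _ = positive⁻¹ (ratio (suc m) (suc k)) {{normalize-pos (suc m) (suc k)}}

  ratio≤1 : ∀ {m k} → m ℕ.≤ suc k → ratio m (suc k) ≤ 1ℚ
  ratio≤1 {m} {k} m≤n = *-cancelʳ-≤-pos (toℚ (suc k)) {{positive (toℚ-pos k)}}
    (subst₂ _≤_ (sym (ratio*n≡m m k)) (sym (*-identityˡ (toℚ (suc k)))) (toℚ-mono-≤ m≤n))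

  ratio<1 : ∀ {m k} → m ℕ.< suc k → ratio m (suc k) < 1ℚ
  ratio<1 {m} {k} m<n = *-cancelʳ-<-nonNeg (toℚ (suc k)) {{nonNegative (toℚ-nonNeg (suc k))}}
    (subst₂ _<_ (sym (ratio*n≡m m k)) (sym (*-identityˡ (toℚ (suc k)))) (toℚ-mono-< m<n))

  p≤1⇒0≤1-p : ∀ {p} → p ≤ 1ℚ → 0ℚ ≤ 1ℚ - p
  p≤1⇒0≤1-p {p} p≤1 = subst (_≤ 1ℚ - p) (+-inverseʳ p) (+-monoˡ-≤ (- p) p≤1)

  p<1⇒0<1-p : ∀ {p} → p < 1ℚ → 0ℚ < 1ℚ - p
  p<1⇒0<1-p {p} p<1 = subst (_< 1ℚ - p) (+-inverseʳ p) (+-monoˡ-< (- p) p<1)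

  1-[1-r]≡r : ∀ r → 1ℚ - (1ℚ - r) ≡ r
  1-[1-r]≡r r = solve 1 (λ r → con 1ℚ :- (con 1ℚ :- r) := r) refl r
    where open ℚ.+-*-Solver

  1≤[1+e]*ε : ∀ ε → 0ℚ < ε → ∃[ e ] 1ℚ ≤ toℚ (suc e) * ε
  1≤[1+e]*ε (mkℚ (+ zero)   _ _) (*<* (ℤ.+<+ ()))
  1≤[1+e]*ε (mkℚ ℤ.-[1+ _ ] _ _) (*<* ())
  1≤[1+e]*ε ε@(mkℚ (+ suc a) e _) _ = e , (begin
    1ℚ                                   ≤⟨ toℚ-mono-≤ {1} {suc a} (ℕ.s≤s ℕ.z≤n) ⟩
    toℚ (suc a)                          ≡⟨ sym (ratio*n≡m (suc a) e) ⟩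
    ratio (suc a) (suc e) * toℚ (suc e)  ≡⟨ *-comm (ratio (suc a) (suc e)) (toℚ (suc e)) ⟩
    toℚ (suc e) * ratio (suc a) (suc e)  ≡⟨ cong (toℚ (suc e) *_) (↥p/↧p≡p ε) ⟩
    toℚ (suc e) * ε                      ∎)
    where open ≤-Reasoning

  -- After multiplying by E·n: (1 - ε)·E·m·d ≤ (E - 1)·m·d ≤ E·n·X.
  [1-ε][m/n]d≤X : ∀ {ε e m k d X} → 1ℚ ≤ toℚ (suc e) * ε →
    suc e ℕ.* m ℕ.* d ℕ.≤ suc e ℕ.* suc k ℕ.* X ℕ.+ m ℕ.* d →
    ((1ℚ - ε) * (1ℚ - (1ℚ - ratio m (suc k)))) * toℚ d ≤ toℚ X
  [1-ε][m/n]d≤X {ε} {e} {m} {k} {d} {X} 1≤Eε Emd≤EnX+md =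
    *-cancelʳ-≤-pos (E * n) {{pos*pos⇒pos E {{positive (toℚ-pos e)}} n {{positive (toℚ-pos k)}}}} (begin
      ((1ℚ - ε) * (1ℚ - (1ℚ - r))) * toℚ d * (E * n)
        ≡⟨ solve 5 (λ ε r d E n → ((con 1ℚ :- ε) :* (con 1ℚ :- (con 1ℚ :- r))) :* d :* (E :* n)
                     := ((con 1ℚ :- ε) :* E) :* ((r :* n) :* d)) refl ε r (toℚ d) E n ⟩
      ((1ℚ - ε) * E) * ((r * n) * toℚ d)
        ≡⟨ cong (λ z → ((1ℚ - ε) * E) * (z * toℚ d)) (ratio*n≡m m k) ⟩
      ((1ℚ - ε) * E) * md
        ≤⟨ *-monoʳ-≤-nonNeg md {{nonNegative md≥0}} (begin
             (1ℚ - ε) * E  ≡⟨ solve 2 (λ ε E → (con 1ℚ :- ε) :* E := E :- E :* ε) refl ε E ⟩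
             E - E * ε     ≤⟨ +-monoʳ-≤ E (neg-antimono-≤ 1≤Eε) ⟩
             E - 1ℚ        ∎) ⟩
      (E - 1ℚ) * md
        ≡⟨ solve 2 (λ E md → (E :- con 1ℚ) :* md := E :* md :- md) refl E md ⟩
      E * md - md
        ≤⟨ +-monoˡ-≤ (- md) (begin
             E * md
               ≡⟨ sym (*-assoc E (toℚ m) (toℚ d)) ⟩
             E * toℚ m * toℚ d
               ≡⟨ sym (trans (toℚ-homo-* (suc e ℕ.* m) d) (cong (_* toℚ d) (toℚ-homo-* (suc e) m))) ⟩
             toℚ (suc e ℕ.* m ℕ.* d)
               ≤⟨ toℚ-mono-≤ Emd≤EnX+md ⟩
             toℚ (suc e ℕ.* suc k ℕ.* X ℕ.+ m ℕ.* d)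
               ≡⟨ trans (toℚ-homo-+ (suc e ℕ.* suc k ℕ.* X) (m ℕ.* d))
                        (cong₂ _+_ (trans (toℚ-homo-* (suc e ℕ.* suc k) X) (cong (_* toℚ X) (toℚ-homo-* (suc e) (suc k))))
                                   (toℚ-homo-* m d)) ⟩
             E * n * toℚ X + md ∎) ⟩
      (E * n * toℚ X + md) - md
        ≡⟨ solve 4 (λ E n X md → (E :* n :* X :+ md) :- md := X :* (E :* n)) refl E n (toℚ X) md ⟩
      toℚ X * (E * n) ∎)
    where
    open ≤-Reasoning
    open ℚ.+-*-Solver
    E  = toℚ (suc e)
    n  = toℚ (suc k)
    r  = ratio m (suc k)
    md = toℚ m * toℚ d
    md≥0 : 0ℚ ≤ md
    md≥0 = subst (0ℚ ≤_) (toℚ-homo-* m d) (toℚ-nonNeg (m ℕ.* d))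

  -- Probabilities of events

  module _ {A : Set} (f : A → ℚ) where

    productℚ-nonNeg : (∀ x → 0ℚ ≤ f x) → ∀ xs → 0ℚ ≤ productℚ (map f xs)
    productℚ-nonNeg f≥0 []       = nonNegative⁻¹ 1ℚ
    productℚ-nonNeg f≥0 (x ∷ xs) = nonNegative⁻¹ _
      {{nonNeg*nonNeg⇒nonNeg (f x) {{nonNegative (f≥0 x)}} _ {{nonNegative (productℚ-nonNeg f≥0 xs)}}}}

    productℚ-pos : (∀ x → 0ℚ < f x) → ∀ xs → 0ℚ < productℚ (map f xs)
    productℚ-pos f>0 []       = positive⁻¹ 1ℚ
    productℚ-pos f>0 (x ∷ xs) = positive⁻¹ _
      {{pos*pos⇒pos (f x) {{positive (f>0 x)}} _ {{positive (productℚ-pos f>0 xs)}}}}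

    sumℚ-nonNeg : (∀ x → 0ℚ ≤ f x) → ∀ xs → 0ℚ ≤ sumℚ (map f xs)
    sumℚ-nonNeg f≥0 []       = ≤-refl
    sumℚ-nonNeg f≥0 (x ∷ xs) = +-mono-≤ (f≥0 x) (sumℚ-nonNeg f≥0 xs)

    sumℚ-pos : (∀ x → 0ℚ ≤ f x) → ∀ {xs} → Any (λ x → 0ℚ < f x) xs → 0ℚ < sumℚ (map f xs)
    sumℚ-pos f≥0 {x ∷ xs} (here fx>0)    = +-mono-<-≤ fx>0 (sumℚ-nonNeg f≥0 xs)
    sumℚ-pos f≥0 {x ∷ xs} (there ∃fy>0) = +-mono-≤-< (f≥0 x) (sumℚ-pos f≥0 ∃fy>0)

  module _ {n : ℕ} {p : ℚ} (p≥0 : 0ℚ ≤ p) (1-p>0 : 0ℚ < 1ℚ - p) where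

    weight-nonNeg : ∀ (S : VSet n) → 0ℚ ≤ weight p S
    weight-nonNeg S = productℚ-nonNeg _ factor≥0 (allFin n)
      where
      factor≥0 : ∀ i → 0ℚ ≤ (if S i then 1ℚ - p else p)
      factor≥0 i with S i
      ... | true  = <⇒≤ 1-p>0
      ... | false = p≥0

    weight-pos : ∀ (S : VSet n) → (∀ i → ¬ T (S i) → 0ℚ < p) → 0ℚ < weight p S
    weight-pos S p>0 = productℚ-pos _ factor>0 (allFin n)
      where
      factor>0 : ∀ i → 0ℚ < (if S i then 1ℚ - p else p)
      factor>0 i with S i | p>0 i
      ... | true  | _      = 1-p>0
      ... | false | i∉S⇒p>0 = i∉S⇒p>0 (λ ())

    Pr>0 : ∀ (E : VSet n → Bool) → Any (λ S → T (E S) × 0ℚ < weight p S) (allSubsets n) → 0ℚ < Pr p E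
    Pr>0 E witness = sumℚ-pos _ term≥0 (Any.map term>0 witness)
      where
      term≥0 : ∀ S → 0ℚ ≤ (if E S then weight p S else 0ℚ)
      term≥0 S with E S
      ... | true  = weight-nonNeg S
      ... | false = ≤-refl
      term>0 : ∀ {S} → T (E S) × 0ℚ < weight p S → 0ℚ < (if E S then weight p S else 0ℚ)
      term>0 {S} (ES , w>0) with E S
      ... | true = w>0

  module _ {ε : ℚ} {e n m : ℕ} (G : Digraph (suc n)) (1≤Eε : 1ℚ ≤ toℚ (suc e) * ε) where

    private
      p = 1ℚ - ratio m (suc n)

    good⇒event : ∀ S → 1 ℕ.≤ m → T (good? (suc e) G m S) → T (event G ε p m S)
    good⇒event S m≥1 good = T-does³ (_ ≤? _) (_ ≤? _) (size S ℕ.≟ m) out-ok in-ok size≡m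
      where
      T-does³ : ∀ {A B C : Set} (a? : Dec A) (b? : Dec B) (c? : Dec C) → A → B → C → T (does a? ∧ does b? ∧ does c?)
      T-does³ (yes _) (yes _) (yes _) _ _ _ = _
      T-does³ (no ¬a) _       _       a _ _ = ¬a a
      T-does³ (yes _) (no ¬b) _       _ b _ = ¬b b
      T-does³ (yes _) (yes _) (no ¬c) _ _ c = ¬c c
      parts = Equivalence.to (T-∧ {countB S ≡ᵇ m} {not (deficient? (suc e) G m S)}) good
      size≡m : size S ≡ m
      size≡m = trans (size≡countB S) (ℕ.≡ᵇ⇒≡ (countB S) m (proj₁ parts))
      nonempty : 0 ℕ.< length (verts S)
      nonempty = subst (0 ℕ.<_) (sym size≡m) m≥1
      out-low : Fin (suc n) → Bool
      out-low v = low? (suc e) (suc n) m (δ⁺ G) ∣ S ∩ adj G v ∣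
      not-low : ∀ v → ¬ T (low-at? (suc e) G m v S)
      not-low v = T-not-any (λ v → low-at? (suc e) G m v S) (proj₂ parts) (∈-allFin v)
      degree-kept : ∀ d j → ¬ T (low? (suc e) (suc n) m d j) → ((1ℚ - ε) * (1ℚ - p)) * toℚ d ≤ toℚ j
      degree-kept d j ¬low = [1-ε][m/n]d≤X {ε} {e} {m} {n} {d} {j} 1≤Eε (ℕ.≮⇒≥ (¬low ∘ ℕ.<⇒<ᵇ))
      out-ok : ((1ℚ - ε) * (1ℚ - p)) * toℚ (δ⁺ G) ≤ toℚ (δ⁺In G S)
      out-ok =
        let (w , δ⁺In≡) = minList-map-attained (outdegIn G S) (verts S) nonempty
        in subst (λ y → ((1ℚ - ε) * (1ℚ - p)) * toℚ (δ⁺ G) ≤ toℚ y) (sym δ⁺In≡)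
             (degree-kept (δ⁺ G) (outdegIn G S w) (not-low w ∘ Equivalence.from (T-∨ {out-low w}) ∘ inj₁))
      in-ok : ((1ℚ - ε) * (1ℚ - p)) * toℚ (δ⁻ G) ≤ toℚ (δ⁻In G S)
      in-ok =
        let (w , δ⁻In≡) = minList-map-attained (indegIn G S) (verts S) nonempty
        in subst (λ y → ((1ℚ - ε) * (1ℚ - p)) * toℚ (δ⁻ G) ≤ toℚ y) (sym δ⁻In≡)
             (degree-kept (δ⁻ G) (indegIn G S w) (not-low w ∘ Equivalence.from (T-∨ {out-low w}) ∘ inj₂))

    good-subset⇒Pr>0 : suc n ℕ.≤ 2 ℕ.* m → m ℕ.≤ suc n → Any (T ∘ good? (suc e) G m) (allSubsets (suc n)) →
                       0ℚ < Pr p (event G ε p m)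
    good-subset⇒Pr>0 n≤2m m≤n good-subset =
      Pr>0 p≥0 1-p>0 (event G ε p m)
        (Any.map (λ {S} good → good⇒event S m≥1 good , weight-pos p≥0 1-p>0 S (outside⇒p>0 S good)) good-subset)
      where
      m≥1 : 1 ℕ.≤ m
      m≥1 = ℕ.*-cancelˡ-< 2 0 m (ℕ.≤-trans (ℕ.s≤s ℕ.z≤n) n≤2m)
      p≥0 : 0ℚ ≤ p
      p≥0 = p≤1⇒0≤1-p (ratio≤1 m≤n)
      1-p>0 : 0ℚ < 1ℚ - p
      1-p>0 = subst (0ℚ <_) (sym (1-[1-r]≡r (ratio m (suc n)))) (ratio>0 m≥1)
      outside⇒p>0 : ∀ S → T (good? (suc e) G m S) → ∀ i → ¬ T (S i) → 0ℚ < p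
      outside⇒p>0 S good i i∉S =
        let size≡m = ℕ.≡ᵇ⇒≡ (countB S) m (proj₁ (Equivalence.to (T-∧ {countB S ≡ᵇ m}) good))
        in p<1⇒0<1-p (ratio<1 (subst (ℕ._< suc n) size≡m (countB<n S i i∉S)))

open import Data.Nat using (ℕ; zero; suc; _≤_; _*_; _≥_; NonZero)
open import Data.Nat.Properties using (<⇒≱)
open import Data.Rational using (ℚ; 0ℚ; 1ℚ; _<_; _-_)

lemma7p1 : (ε : ℚ) → 0ℚ < ε → (a b : ℕ) → .{{NonZero a}} → .{{NonZero b}} →
    ∃[ n₀ ] ∀ (n : ℕ) → n ≥ n₀ → (G : Digraph n) →
    atLeastPow (δ⁺ G) n a b → atLeastPow (δ⁻ G) n a b →
    (m : ℕ) → n ≤ 2 * m → m ≤ n →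
    0ℚ < Pr (1ℚ - ratio m n) (event G ε (1ℚ - ratio m n) m)
lemma7p1 ε 0<ε a b = n₀ , positive
  where
  e = proj₁ (1≤[1+e]*ε ε 0<ε)
  eventually = good-subset-exists-eventually e b
  n₀ = proj₁ eventually
  positive : ∀ (n : ℕ) → n ≥ n₀ → (G : Digraph n) →
    atLeastPow (δ⁺ G) n a b → atLeastPow (δ⁻ G) n a b →
    (m : ℕ) → n ≤ 2 * m → m ≤ n →
    0ℚ < Pr (1ℚ - ratio m n) (event G ε (1ℚ - ratio m n) m)
  positive zero    n≥n₀ = contradiction n≥n₀ (<⇒≱ (proj₁ (proj₂ eventually)))
  positive (suc n) n≥n₀ G hp hm m n≤2m m≤n =
    good-subset⇒Pr>0 {e = e} G (proj₂ (1≤[1+e]*ε ε 0<ε)) n≤2m m≤n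
      (proj₂ (proj₂ eventually) G n≥n₀ hp hm m≤n n≤2m)
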